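{- There exists a bijection $$\theta_2:\bigsqcup_{i\ge0}(\mathscr{A}^{\mathrm{V}}_i\times\mathscr{B}^{\mathrm{V}}_i)\to\mathscr{D}^{\mathrm{e}}\times\mathscr{D},\qquad(\lambda,\mu)\mapsto(\beta,\gamma),$$ such that $|\lambda|+|\mu|=|\beta|+|\gamma|$.
   Context: Partitions are finite weakly increasing lists of positive integers; $|\lambda|$ is the sum of parts. For $i\ge0$, $\mathscr{A}^{\mathrm{V}}_i$ is the set of partitions $\lambda$ with either $2i$ or $2i-1$ parts in which any two adjacent parts differ by at least $2$, and such that if the number of parts is $2i-1$ then the smallest part is greater than $1$. $\mathscr{B}^{\mathrm{V}}_i$ is the set of partitions into distinct parts whose smallest part is at least $2i+1$. $\mathscr{D}^{\mathrm{e}}$ is the set of partitions into distinct even parts and $\mathscr{D}$ is the set of partitions into distinct parts. -}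

module Defs where

open import Data.Nat using (ℕ; zero; suc; _+_; _*_; _≤ᵇ_; _<ᵇ_)
open import Data.Bool using (Bool; true; false; _∧_; _∨_; not; if_then_else_)
open import Data.Bool using (T)
open import Data.List using (List; []; _∷_; length)
open import Data.Nat.ListAction using (sum)
open import Data.Product using (Σ; _×_; proj₁)
open import Data.Nat using (_≡ᵇ_)

-- All predicates are Bool-valued so that membership proofs (T b) are
-- proof-irrelevant and subsets Σ (List ℕ) (T ∘ p) have the right equality.

allB : (ℕ → Bool) → List ℕ → Bool
allB p [] = true
allB p (x ∷ xs) = p x ∧ allB p xs

adjacent : (ℕ → ℕ → Bool) → List ℕ → Bool
adjacent R [] = true
adjacent R (x ∷ []) = true
adjacent R (x ∷ y ∷ xs) = R x y ∧ adjacent R (y ∷ xs)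

positive : ℕ → Bool
positive n = 1 ≤ᵇ n

isPartition : List ℕ → Bool
isPartition xs = allB positive xs ∧ adjacent _≤ᵇ_ xs

Partition : Set
Partition = Σ (List ℕ) (λ xs → T (isPartition xs))

∣_∣ₚ : List ℕ → ℕ
∣ xs ∣ₚ = sum xs

-- smallest part (first element, list is increasing); 0 for empty
smallest : List ℕ → ℕ
smallest [] = zero
smallest (x ∷ _) = x

isAV : ℕ → List ℕ → Bool
isAV i xs =
  isPartition xs ∧ adjacent (λ x y → (x + 2) ≤ᵇ y) xs ∧
  ( (length xs ≡ᵇ 2 * i)
  ∨ ((suc (length xs) ≡ᵇ 2 * i) ∧ (1 <ᵇ smallest xs)) )

isBV : ℕ → List ℕ → Bool
isBV i xs = isPartition xs ∧ adjacent _<ᵇ_ xs ∧ allB (λ x → suc (2 * i) ≤ᵇ x) xs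

even : ℕ → Bool
even zero = true
even (suc zero) = false
even (suc (suc n)) = even n

isDe : List ℕ → Bool
isDe xs = isPartition xs ∧ adjacent _<ᵇ_ xs ∧ allB even xs

isD : List ℕ → Bool
isD xs = isPartition xs ∧ adjacent _<ᵇ_ xs

AV BV : ℕ → Set
AV i = Σ (List ℕ) (λ xs → T (isAV i xs))
BV i = Σ (List ℕ) (λ xs → T (isBV i xs))

De D : Set
De = Σ (List ℕ) (λ xs → T (isDe xs))
D  = Σ (List ℕ) (λ xs → T (isD xs))

Domain : Set
Domain = Σ ℕ (λ i → AV i × BV i)

{-# OPTIONS --safe #-}

-- Pad λ ∈ A^V_i with a part 0 if needed to get exactly 2i parts y₁ < ⋯ < y_{2i} with gaps at least 2, and
-- record them by the excesses δ_k = y_k − y_{k−1} − 2 (δ₁ = y₁), an arbitrary list of 2i naturals. Writing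
-- δ_k = ε_k + 2 η_k with ε_k ∈ {0, 1}, the η are the excesses of a sequence z₁ < ⋯ < z_{2i} with z₁ ≥ 0 and
-- gaps at least 1, which after dropping a part 0 and doubling is β ∈ D^e. The bits say which of the parts
-- 2i, …, 1 to add to μ ∈ B^V_i, whose parts all exceed 2i, to obtain γ ∈ D. Since y_k = 2 z_k + ε₁ + ⋯ + ε_k,
-- |λ| = |β| + Σ_j ε_j (2i + 1 − j), and the last sum is exactly what the bits add to μ.

module Submission where

open import Defs
open import Data.Nat using (_+_)
open import Data.Product using (Σ; _×_; _,_; proj₁; proj₂)
open import Function.Bundles using (_⤖_; Bijection)
open import Relation.Binary.PropositionalEquality using (_≡_)

open import Data.Bool using (Bool; true; false; not; T; if_then_else_)
open import Data.Bool.Properties using (T-∧; T-∨; T-≡; T-irrelevant; not-involutive)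
open import Data.Empty using (⊥-elim)
open import Data.List using (List; []; _∷_; length; map; zipWith; unzipWith)
open import Data.List.Properties
  using ( length-map; length-zipWith; length-unzipWith₁; length-unzipWith₂
        ; zipWith-map; zipWith-unzipWith; unzipWith-zipWith)
open import Data.Nat using (ℕ; zero; suc; _*_; _∸_; _⊓_; _≤_; _<_; _≤ᵇ_; z≤n; s≤s; _≟_; ⌊_/2⌋)
open import Data.Nat.ListAction using (sum)
open import Data.Nat.Properties
open import Data.Nat.Tactic.RingSolver using (solve-∀)
open import Data.Product using (uncurry′)
open import Data.Sum using (_⊎_; inj₁; inj₂)
import Data.Sum as Sum
open import Function using (_∘_)
open import Function.Bundles using (_↔_; _⇔_; mk↔ₛ′; mk⇔; Equivalence)
open import Function.Properties.Inverse using (↔-trans; ↔-sym; ↔⇒⤖)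
open import Relation.Binary.PropositionalEquality using (refl; sym; trans; cong; cong₂; subst; module ≡-Reasoning)
open import Relation.Nullary using (yes; no)

open Equivalence using (to; from)

bit : Bool → ℕ
bit false = 0
bit true  = 1

halve : ℕ → Bool × ℕ
halve n = not (even n) , ⌊ n /2⌋

unhalve : Bool → ℕ → ℕ
unhalve b h = bit b + 2 * h

m+2*[1+n]≡2+[m+2*n] : ∀ m n → m + 2 * suc n ≡ 2 + (m + 2 * n)
m+2*[1+n]≡2+[m+2*n] = solve-∀

even-unhalve : ∀ b h → even (unhalve b h) ≡ not b
even-unhalve false zero    = refl
even-unhalve true  zero    = refl
even-unhalve b     (suc h) = trans (cong even (m+2*[1+n]≡2+[m+2*n] (bit b) h)) (even-unhalve b h)

⌊unhalve/2⌋ : ∀ b h → ⌊ unhalve b h /2⌋ ≡ h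
⌊unhalve/2⌋ false zero    = refl
⌊unhalve/2⌋ true  zero    = refl
⌊unhalve/2⌋ b     (suc h) = trans (cong ⌊_/2⌋ (m+2*[1+n]≡2+[m+2*n] (bit b) h)) (cong suc (⌊unhalve/2⌋ b h))

halve-unhalve : ∀ bh → halve (uncurry′ unhalve bh) ≡ bh
halve-unhalve (b , h) = cong₂ _,_ (trans (cong not (even-unhalve b h)) (not-involutive b)) (⌊unhalve/2⌋ b h)

unhalve-halve : ∀ n → uncurry′ unhalve (halve n) ≡ n
unhalve-halve zero          = refl
unhalve-halve (suc zero)    = refl
unhalve-halve (suc (suc n)) =
  trans (m+2*[1+n]≡2+[m+2*n] (bit (not (even n))) ⌊ n /2⌋) (cong (2 +_) (unhalve-halve n))

even-2*n : ∀ n → T (even (2 * n))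
even-2*n n = from T-≡ (even-unhalve false n)

⌊2*n/2⌋≡n : ∀ n → ⌊ 2 * n /2⌋ ≡ n
⌊2*n/2⌋≡n = ⌊unhalve/2⌋ false

even⇒2*⌊n/2⌋≡n : ∀ {n} → T (even n) → 2 * ⌊ n /2⌋ ≡ n
even⇒2*⌊n/2⌋≡n {n} ev = trans (cong (λ e → unhalve (not e) ⌊ n /2⌋) (sym (to T-≡ ev))) (unhalve-halve n)

even-suc : ∀ n → even (suc n) ≡ not (even n)
even-suc zero          = refl
even-suc (suc zero)    = refl
even-suc (suc (suc n)) = even-suc n

even-pred : ∀ n → T (even (suc n)) → even n ≡ false
even-pred n ev = trans (sym (not-involutive (even n))) (cong not (trans (sym (even-suc n)) (to T-≡ ev)))

1+n≡2*i⇒odd : ∀ n i → suc n ≡ 2 * i → even n ≡ false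
1+n≡2*i⇒odd n i e = even-pred n (subst (T ∘ even) (sym e) (even-2*n i))

sum-zipWith-+ : ∀ xs ys → length xs ≡ length ys → sum (zipWith _+_ xs ys) ≡ sum xs + sum ys
sum-zipWith-+ []       []       _   = refl
sum-zipWith-+ (x ∷ xs) (y ∷ ys) len =
  trans (cong (x + y +_) (sum-zipWith-+ xs ys (suc-injective len))) (interchange x y (sum xs) (sum ys))
  where
  interchange : ∀ x y s t → x + y + (s + t) ≡ x + s + (y + t)
  interchange = solve-∀

sum-map-* : ∀ a xs → sum (map (a *_) xs) ≡ a * sum xs
sum-map-* a []       = sym (*-zeroʳ a)
sum-map-* a (x ∷ xs) = trans (cong (a * x +_) (sum-map-* a xs)) (sym (*-distribˡ-+ a x (sum xs)))

data Gapped (g : ℕ) : ℕ → List ℕ → Set where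
  []  : ∀ {s} → Gapped g s []
  _∷_ : ∀ {s x xs} → s ≤ x → Gapped g (g + x) xs → Gapped g s (x ∷ xs)

Gapped-mono : ∀ {g g′ s s′ xs} → g′ ≤ g → s′ ≤ s → Gapped g s xs → Gapped g′ s′ xs
Gapped-mono g′≤g s′≤s []          = []
Gapped-mono g′≤g s′≤s (s≤x ∷ gxs) = ≤-trans s′≤s s≤x ∷ Gapped-mono g′≤g (+-monoˡ-≤ _ g′≤g) gxs

Gapped-scale : ∀ a {g s xs} → Gapped g s xs → Gapped (a * g) (a * s) (map (a *_) xs)
Gapped-scale a []                             = []
Gapped-scale a {g} (_∷_ {x = x} {xs} s≤x gxs) =
  *-monoʳ-≤ a s≤x ∷ subst (λ t → Gapped (a * g) t (map (a *_) xs)) (*-distribˡ-+ a g x) (Gapped-scale a gxs)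

Gapped-halve : ∀ {s hs} → Gapped 1 (suc (2 * s)) (map (2 *_) hs) → Gapped 1 (suc s) hs
Gapped-halve {hs = []}    []            = []
Gapped-halve {s} {h ∷ hs} (2s<2h ∷ gxs) = *-cancelˡ-< 2 s h 2s<2h ∷ Gapped-halve gxs

differences : ℕ → ℕ → List ℕ → List ℕ
differences g s []       = []
differences g s (x ∷ xs) = x ∸ s ∷ differences g (g + x) xs

accumulate : ℕ → ℕ → List ℕ → List ℕ
accumulate g s []       = []
accumulate g s (d ∷ ds) = s + d ∷ accumulate g (g + (s + d)) ds

length-differences : ∀ g s xs → length (differences g s xs) ≡ length xs
length-differences g s []       = refl
length-differences g s (x ∷ xs) = cong suc (length-differences g (g + x) xs)

length-accumulate : ∀ g s ds → length (accumulate g s ds) ≡ length ds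
length-accumulate g s []       = refl
length-accumulate g s (d ∷ ds) = cong suc (length-accumulate g (g + (s + d)) ds)

Gapped-accumulate : ∀ g s ds → Gapped g s (accumulate g s ds)
Gapped-accumulate g s []       = []
Gapped-accumulate g s (d ∷ ds) = m≤m+n s d ∷ Gapped-accumulate g (g + (s + d)) ds

accumulate-differences : ∀ {g s xs} → Gapped g s xs → accumulate g s (differences g s xs) ≡ xs
accumulate-differences []                    = refl
accumulate-differences (_∷_ {x = x} s≤x gxs) rewrite m+[n∸m]≡n s≤x = cong (x ∷_) (accumulate-differences gxs)

differences-accumulate : ∀ g s ds → differences g s (accumulate g s ds) ≡ ds
differences-accumulate g s []       = refl
differences-accumulate g s (d ∷ ds) = cong₂ _∷_ (m+n∸m≡n s d) (differences-accumulate g (g + (s + d)) ds)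

accumulate-+ : ∀ {g h s t} ds es →
               accumulate (g + h) (s + t) (zipWith _+_ ds es) ≡ zipWith _+_ (accumulate g s ds) (accumulate h t es)
accumulate-+                 []       _        = refl
accumulate-+                 (_ ∷ _)  []       = refl
accumulate-+ {g} {h} {s} {t} (d ∷ ds) (e ∷ es) =
  cong₂ _∷_ (interchange s t d e)
            (trans (cong (λ u → accumulate (g + h) u (zipWith _+_ ds es)) (shuffle g h s t d e)) (accumulate-+ ds es))
  where
  interchange : ∀ s t d e → s + t + (d + e) ≡ s + d + (t + e)
  interchange = solve-∀
  shuffle : ∀ g h s t d e → g + h + (s + t + (d + e)) ≡ g + (s + d) + (h + (t + e))
  shuffle = solve-∀

accumulate-* : ∀ a {g s} ds → accumulate (a * g) (a * s) (map (a *_) ds) ≡ map (a *_) (accumulate g s ds)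
accumulate-* a         []       = refl
accumulate-* a {g} {s} (d ∷ ds) =
  cong₂ _∷_ (sym (*-distribˡ-+ a s d))
            (trans (cong (λ u → accumulate (a * g) u (map (a *_) ds)) (distrib a g s d)) (accumulate-* a ds))
  where
  distrib : ∀ a g s d → a * g + (a * s + a * d) ≡ a * (g + (s + d))
  distrib = solve-∀

bitWeight : List Bool → ℕ
bitWeight []      = 0
bitWeight (b ∷ ε) = bit b * suc (length ε) + bitWeight ε

sum-accumulate-bits : ∀ t ε → sum (accumulate 0 t (map bit ε)) ≡ t * length ε + bitWeight ε
sum-accumulate-bits t []      = sym (trans (+-identityʳ (t * 0)) (*-zeroʳ t))
sum-accumulate-bits t (b ∷ ε) =
  trans (cong (t + bit b +_) (sum-accumulate-bits (t + bit b) ε)) (regroup t (bit b) (length ε) (bitWeight ε))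
  where
  regroup : ∀ t c n w → t + c + ((t + c) * n + w) ≡ t * suc n + (c * suc n + w)
  regroup = solve-∀

sum-accumulate-unhalve : ∀ ε η → length ε ≡ length η →
                         sum (accumulate 2 0 (zipWith unhalve ε η)) ≡ 2 * sum (accumulate 1 0 η) + bitWeight ε
sum-accumulate-unhalve ε η len = begin
  sum (accumulate 2 0 (zipWith unhalve ε η))
    ≡⟨ cong (sum ∘ accumulate 2 0) (sym (zipWith-map _+_ bit (2 *_) ε η)) ⟩
  sum (accumulate 2 0 (zipWith _+_ (map bit ε) (map (2 *_) η)))
    ≡⟨ cong sum (accumulate-+ (map bit ε) (map (2 *_) η)) ⟩
  sum (zipWith _+_ bits (accumulate 2 0 (map (2 *_) η)))
    ≡⟨ cong (sum ∘ zipWith _+_ bits) (accumulate-* 2 η) ⟩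
  sum (zipWith _+_ bits halves)
    ≡⟨ sum-zipWith-+ bits halves lengths ⟩
  sum bits + sum halves
    ≡⟨ cong₂ _+_ (sum-accumulate-bits 0 ε) (sum-map-* 2 (accumulate 1 0 η)) ⟩
  bitWeight ε + 2 * sum (accumulate 1 0 η)
    ≡⟨ +-comm (bitWeight ε) _ ⟩
  2 * sum (accumulate 1 0 η) + bitWeight ε
    ∎
  where
  open ≡-Reasoning
  bits halves : List ℕ
  bits   = accumulate 0 0 (map bit ε)
  halves = map (2 *_) (accumulate 1 0 η)
  lengths : length bits ≡ length halves
  lengths = begin
    length bits               ≡⟨ length-accumulate 0 0 (map bit ε) ⟩
    length (map bit ε)        ≡⟨ length-map bit ε ⟩
    length ε                  ≡⟨ len ⟩
    length η                  ≡⟨ sym (length-accumulate 1 0 η) ⟩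
    length (accumulate 1 0 η) ≡⟨ sym (length-map (2 *_) (accumulate 1 0 η)) ⟩
    length halves             ∎

insertIf : Bool → ℕ → List ℕ → List ℕ
insertIf false k μ = μ
insertIf true  k μ = k ∷ μ

peel : ℕ → List ℕ → Bool × List ℕ
peel k []       = false , []
peel k (x ∷ xs) with x ≟ k
... | yes _ = true , xs
... | no  _ = false , x ∷ xs

-- Of n bits, the j-th decides whether the part n + 1 − j is inserted.
insertSmall : List Bool → List ℕ → List ℕ
insertSmall []      μ = μ
insertSmall (b ∷ ε) μ = insertSmall ε (insertIf b (suc (length ε)) μ)

extractSmall : ℕ → List ℕ → List Bool × List ℕ
extractSmall zero    γ = [] , γ
extractSmall (suc n) γ =
  let ε , μ  = extractSmall n γ
      b , μ′ = peel (suc n) μ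
  in b ∷ ε , μ′

Gapped-insertIf : ∀ b {k μ} → Gapped 1 (suc k) μ → Gapped 1 k (insertIf b k μ)
Gapped-insertIf false {k} gμ = Gapped-mono ≤-refl (n≤1+n k) gμ
Gapped-insertIf true      gμ = ≤-refl ∷ gμ

Gapped-peel : ∀ {k μ} → Gapped 1 k μ → Gapped 1 (suc k) (proj₂ (peel k μ))
Gapped-peel             []         = []
Gapped-peel {k} {x ∷ _} (k≤x ∷ gμ) with x ≟ k
... | yes refl = gμ
... | no  x≢k  = ≤∧≢⇒< k≤x (x≢k ∘ sym) ∷ gμ

insertIf-peel : ∀ k μ → insertIf (proj₁ (peel k μ)) k (proj₂ (peel k μ)) ≡ μ
insertIf-peel k []       = refl
insertIf-peel k (x ∷ xs) with x ≟ k
... | yes refl = refl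
... | no  _    = refl

peel-insertIf : ∀ b {k μ} → Gapped 1 (suc k) μ → peel k (insertIf b k μ) ≡ (b , μ)
peel-insertIf true  {k} _ with k ≟ k
... | yes _   = refl
... | no  k≢k = ⊥-elim (k≢k refl)
peel-insertIf false {k} {[]}    _         = refl
peel-insertIf false {k} {x ∷ _} (k<x ∷ _) with x ≟ k
... | yes refl = ⊥-elim (<-irrefl refl k<x)
... | no  _    = refl

length-extractSmall : ∀ n γ → length (proj₁ (extractSmall n γ)) ≡ n
length-extractSmall zero    γ = refl
length-extractSmall (suc n) γ = cong suc (length-extractSmall n γ)

Gapped-insertSmall : ∀ ε {μ} → Gapped 1 (suc (length ε)) μ → Gapped 1 1 (insertSmall ε μ)
Gapped-insertSmall []      gμ = gμ
Gapped-insertSmall (b ∷ ε) gμ = Gapped-insertSmall ε (Gapped-insertIf b gμ)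

Gapped-extractSmall : ∀ n {γ} → Gapped 1 1 γ → Gapped 1 (suc n) (proj₂ (extractSmall n γ))
Gapped-extractSmall zero    gγ = gγ
Gapped-extractSmall (suc n) gγ = Gapped-peel (Gapped-extractSmall n gγ)

insertSmall-extractSmall : ∀ n γ → insertSmall (proj₁ (extractSmall n γ)) (proj₂ (extractSmall n γ)) ≡ γ
insertSmall-extractSmall zero    γ = refl
insertSmall-extractSmall (suc n) γ
  rewrite length-extractSmall n γ | insertIf-peel (suc n) (proj₂ (extractSmall n γ)) = insertSmall-extractSmall n γ

extractSmall-insertSmall : ∀ ε {μ} → Gapped 1 (suc (length ε)) μ →
                           extractSmall (length ε) (insertSmall ε μ) ≡ (ε , μ)
extractSmall-insertSmall []      _  = refl
extractSmall-insertSmall (b ∷ ε) gμ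
  rewrite extractSmall-insertSmall ε (Gapped-insertIf b gμ) | peel-insertIf b gμ = refl

sum-insertSmall : ∀ ε μ → sum (insertSmall ε μ) ≡ bitWeight ε + sum μ
sum-insertSmall []      μ = refl
sum-insertSmall (b ∷ ε) μ = begin
  sum (insertSmall ε (insertIf b k μ))  ≡⟨ sum-insertSmall ε (insertIf b k μ) ⟩
  bitWeight ε + sum (insertIf b k μ)    ≡⟨ cong (bitWeight ε +_) (sum-insertIf b) ⟩
  bitWeight ε + (bit b * k + sum μ)     ≡⟨ regroup (bitWeight ε) (bit b * k) (sum μ) ⟩
  bit b * k + bitWeight ε + sum μ       ∎
  where
  open ≡-Reasoning
  k : ℕ
  k = suc (length ε)
  sum-insertIf : ∀ b → sum (insertIf b k μ) ≡ bit b * k + sum μ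
  sum-insertIf false = refl
  sum-insertIf true  = cong (_+ sum μ) (sym (*-identityˡ k))
  regroup : ∀ w c m → w + (c + m) ≡ c + w + m
  regroup = solve-∀

pad : List ℕ → List ℕ
pad xs = if even (length xs) then xs else 0 ∷ xs

unpad : List ℕ → List ℕ
unpad []           = []
unpad (zero ∷ xs)  = xs
unpad (suc x ∷ xs) = suc x ∷ xs

pad-even : ∀ {xs} → T (even (length xs)) → pad xs ≡ xs
pad-even ev rewrite to T-≡ ev = refl

pad-odd : ∀ {xs} → even (length xs) ≡ false → pad xs ≡ 0 ∷ xs
pad-odd odd rewrite odd = refl

even-length-pad : ∀ xs → T (even (length (pad xs)))
even-length-pad xs with even (length xs) in eq
... | true  = from T-≡ eq
... | false = from T-≡ (trans (even-suc (length xs)) (cong not eq))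

sum-pad : ∀ xs → sum (pad xs) ≡ sum xs
sum-pad xs with even (length xs)
... | true  = refl
... | false = refl

sum-unpad : ∀ ys → sum (unpad ys) ≡ sum ys
sum-unpad []           = refl
sum-unpad (zero ∷ ys)  = refl
sum-unpad (suc y ∷ ys) = refl

Gapped-pad : ∀ {g xs} → Gapped g g xs → Gapped g 0 (pad xs)
Gapped-pad {g} {xs} gxs with even (length xs)
... | true  = Gapped-mono ≤-refl z≤n gxs
... | false = z≤n ∷ Gapped-mono ≤-refl (≤-reflexive (+-identityʳ g)) gxs

Gapped-unpad : ∀ {g ys} → Gapped (suc g) 0 ys → Gapped (suc g) 1 (unpad ys)
Gapped-unpad {ys = []}        []        = []
Gapped-unpad {ys = zero ∷ _}  (_ ∷ gys) = Gapped-mono ≤-refl (s≤s z≤n) gys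
Gapped-unpad {ys = suc _ ∷ _} (_ ∷ gys) = s≤s z≤n ∷ gys

unpad-pad : ∀ {g xs} → Gapped g 1 xs → unpad (pad xs) ≡ xs
unpad-pad {xs = xs} gxs with even (length xs) | gxs
... | false | _         = refl
... | true  | []        = refl
... | true  | s≤s _ ∷ _ = refl

pad-unpad : ∀ ys → T (even (length ys)) → pad (unpad ys) ≡ ys
pad-unpad []           _  = refl
pad-unpad (zero ∷ ys)  ev = pad-odd (even-pred (length ys) ev)
pad-unpad (suc y ∷ ys) ev = pad-even ev

Gapped⇒allB : ∀ {g s t xs} → t ≤ s → Gapped g s xs → T (allB (t ≤ᵇ_) xs)
Gapped⇒allB     t≤s []                    = _
Gapped⇒allB {g} t≤s (_∷_ {x = x} s≤x gxs) =
  from T-∧ (≤⇒≤ᵇ t≤x , Gapped⇒allB (≤-trans t≤x (m≤n+m x g)) gxs)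
  where
  t≤x : _ ≤ x
  t≤x = ≤-trans t≤s s≤x

Gapped⇒adjacent : ∀ {R : ℕ → ℕ → Bool} {g s xs} →
                  (∀ {x y} → g + x ≤ y → T (R x y)) → Gapped g s xs → T (adjacent R xs)
Gapped⇒adjacent r []                   = _
Gapped⇒adjacent r (_ ∷ [])             = _
Gapped⇒adjacent r (_ ∷ gxs@(gx≤y ∷ _)) = from T-∧ (r gx≤y , Gapped⇒adjacent r gxs)

adjacent⇒Gapped : ∀ {R : ℕ → ℕ → Bool} {g s xs} → (∀ {x y} → T (R x y) → g + x ≤ y) →
                  T (allB (s ≤ᵇ_) xs) → T (adjacent R xs) → Gapped g s xs
adjacent⇒Gapped {R} {g} {xs = []}     r _     _   = []
adjacent⇒Gapped {R} {g} {s} {x ∷ xs} r bound adj = chain (≤ᵇ⇒≤ s x (proj₁ (to T-∧ bound))) adj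
  where
  chain : ∀ {s x xs} → s ≤ x → T (adjacent R (x ∷ xs)) → Gapped g s (x ∷ xs)
  chain {xs = []}    s≤x _   = s≤x ∷ []
  chain {xs = _ ∷ _} s≤x adj = s≤x ∷ chain (r (proj₁ (to T-∧ adj))) (proj₂ (to T-∧ adj))

Gapped⇒isPartition : ∀ {g s xs} → Gapped g (suc s) xs → T (isPartition xs)
Gapped⇒isPartition {g} gxs =
  from T-∧ (Gapped⇒allB (s≤s z≤n) gxs , Gapped⇒adjacent (λ {x} gx≤y → ≤⇒≤ᵇ (≤-trans (m≤n+m x g) gx≤y)) gxs)

isD⇔Gapped : ∀ {xs} → T (isD xs) ⇔ Gapped 1 1 xs
isD⇔Gapped = mk⇔
  (λ p → let part , adj = to T-∧ p in adjacent⇒Gapped (λ {x} {y} → <ᵇ⇒< x y) (proj₁ (to T-∧ part)) adj)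
  (λ gxs → from T-∧ (Gapped⇒isPartition gxs , Gapped⇒adjacent <⇒<ᵇ gxs))

isBV⇔Gapped : ∀ {i xs} → T (isBV i xs) ⇔ Gapped 1 (suc (2 * i)) xs
isBV⇔Gapped {i} {xs} = mk⇔
  (λ p → let _ , rest = to (T-∧ {isPartition xs}) p; adj , bound = to T-∧ rest in
     adjacent⇒Gapped (λ {x} {y} → <ᵇ⇒< x y) bound adj)
  (λ gxs → from T-∧ (Gapped⇒isPartition gxs , from T-∧ (Gapped⇒adjacent <⇒<ᵇ gxs , Gapped⇒allB ≤-refl gxs)))

AVLength : ℕ → List ℕ → Set
AVLength i xs = length xs ≡ 2 * i ⊎ suc (length xs) ≡ 2 * i × 1 < smallest xs

isAV⇔Gapped : ∀ {i xs} → T (isAV i xs) ⇔ (Gapped 2 1 xs × AVLength i xs)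
isAV⇔Gapped = mk⇔
  (λ p → let part , rest = to T-∧ p; gap , shape = to T-∧ rest in
     adjacent⇒Gapped (λ {x} {y} r → subst (_≤ y) (+-comm x 2) (≤ᵇ⇒≤ _ _ r)) (proj₁ (to T-∧ part)) gap ,
     Sum.map (≡ᵇ⇒≡ _ _) (λ t → let e , lt = to T-∧ t in ≡ᵇ⇒≡ _ _ e , <ᵇ⇒< _ _ lt) (to T-∨ shape))
  (λ (gxs , shape) →
     from T-∧ (Gapped⇒isPartition gxs , from T-∧
       ( Gapped⇒adjacent (λ {x} {y} le → ≤⇒≤ᵇ (subst (_≤ y) (+-comm 2 x) le)) gxs
       , from T-∨ (Sum.map (≡⇒≡ᵇ _ _) (λ (e , lt) → from T-∧ (≡⇒≡ᵇ _ _ e , <⇒<ᵇ lt)) shape))))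

AV⇒padded : ∀ {i xs} → T (isAV i xs) → Gapped 2 0 (pad xs) × length (pad xs) ≡ 2 * i
AV⇒padded {i} {xs} p with to (isAV⇔Gapped {i} {xs}) p
... | gxs , inj₁ len =
  subst (λ ys → Gapped 2 0 ys × length ys ≡ 2 * i) (sym (pad-even (subst (T ∘ even) (sym len) (even-2*n i))))
        (Gapped-mono ≤-refl z≤n gxs , len)
AV⇒padded {i} {[]}    p | _ , inj₂ (_ , ())
AV⇒padded {i} {_ ∷ _} p | _ ∷ gxs , inj₂ (len , 2≤x) =
  subst (λ ys → Gapped 2 0 ys × length ys ≡ 2 * i) (sym (pad-odd (1+n≡2*i⇒odd _ i len)))
        ((z≤n ∷ (2≤x ∷ gxs)) , len)

padded⇒AV : ∀ {i ys} → Gapped 2 0 ys → length ys ≡ 2 * i → T (isAV i (unpad ys))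
padded⇒AV {i} {[]}                []                    len = from (isAV⇔Gapped {i} {[]}) ([] , inj₁ len)
padded⇒AV {i} {zero ∷ []}         _                     len with 1+n≡2*i⇒odd 0 i len
... | ()
padded⇒AV {i} {zero ∷ ys@(_ ∷ _)} (_ ∷ gys@(2≤y ∷ _))   len =
  from (isAV⇔Gapped {i} {ys}) (Gapped-mono ≤-refl (s≤s z≤n) gys , inj₂ (len , 2≤y))
padded⇒AV {i} {ys@(suc _ ∷ _)}    (_ ∷ gys)             len =
  from (isAV⇔Gapped {i} {ys}) ((s≤s z≤n ∷ gys) , inj₁ len)

map-2*-⌊/2⌋ : ∀ {xs} → T (allB even xs) → map (2 *_) (map ⌊_/2⌋ xs) ≡ xs
map-2*-⌊/2⌋ {[]}     _  = refl
map-2*-⌊/2⌋ {x ∷ xs} ev =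
  let ev-x , ev-xs = to T-∧ ev in cong₂ _∷_ (even⇒2*⌊n/2⌋≡n ev-x) (map-2*-⌊/2⌋ ev-xs)

map-⌊/2⌋-2* : ∀ hs → map ⌊_/2⌋ (map (2 *_) hs) ≡ hs
map-⌊/2⌋-2* []       = refl
map-⌊/2⌋-2* (h ∷ hs) = cong₂ _∷_ (⌊2*n/2⌋≡n h) (map-⌊/2⌋-2* hs)

allB-even-map-2* : ∀ hs → T (allB even (map (2 *_) hs))
allB-even-map-2* []       = _
allB-even-map-2* (h ∷ hs) = from T-∧ (even-2*n h , allB-even-map-2* hs)

isDe⇒halves : ∀ {xs} → T (isDe xs) → Gapped 1 1 (map ⌊_/2⌋ xs) × map (2 *_) (map ⌊_/2⌋ xs) ≡ xs
isDe⇒halves {xs} p =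
  let part , rest = to (T-∧ {isPartition xs}) p
      adj  , ev   = to T-∧ rest
      doubled     = map-2*-⌊/2⌋ ev
      gxs         = adjacent⇒Gapped (λ {x} {y} → <ᵇ⇒< x y) (proj₁ (to T-∧ part)) adj
  in Gapped-halve (subst (Gapped 1 1) (sym doubled) gxs) , doubled

doubles⇒isDe : ∀ {hs} → Gapped 1 1 hs → T (isDe (map (2 *_) hs))
doubles⇒isDe {hs} ghs =
  from T-∧ (Gapped⇒isPartition gxs , from T-∧ (Gapped⇒adjacent <⇒<ᵇ gxs , allB-even-map-2* hs))
  where
  gxs : Gapped 1 1 (map (2 *_) hs)
  gxs = Gapped-mono (s≤s z≤n) (s≤s z≤n) (Gapped-scale 2 ghs)

subset-≡ : ∀ {P : List ℕ → Bool} {xs ys} {p : T (P xs)} {q : T (P ys)} →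
           xs ≡ ys → _≡_ {A = Σ (List ℕ) (T ∘ P)} (xs , p) (ys , q)
subset-≡ refl = cong (_ ,_) (T-irrelevant _ _)

Code : Set
Code = Σ ℕ λ i → Σ (List ℕ) (λ η → length η ≡ 2 * i) × D

codeWeight : Code → ℕ
codeWeight (_ , (η , _) , (γ , _)) = 2 * sum (accumulate 1 0 η) + sum γ

Code-≡ : ∀ {i i′ η η′ γ γ′} {p : length η ≡ 2 * i} {p′ : length η′ ≡ 2 * i′}
           {q : T (isD γ)} {q′ : T (isD γ′)} →
         i ≡ i′ → η ≡ η′ → γ ≡ γ′ → _≡_ {A = Code} (i , (η , p) , (γ , q)) (i′ , (η′ , p′) , (γ′ , q′))
Code-≡ {i} {η = η} {γ = γ} refl refl refl =
  cong₂ (λ p q → i , (η , p) , (γ , q)) (≡-irrelevant _ _) (T-irrelevant _ _)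

codeOfAV : List ℕ → List Bool × List ℕ
codeOfAV xs = unzipWith halve (differences 2 0 (pad xs))

AVOfCode : List Bool → List ℕ → List ℕ
AVOfCode ε η = unpad (accumulate 2 0 (zipWith unhalve ε η))

module _ {i xs} (xs∈ : T (isAV i xs)) where

  private
    δ : List ℕ
    δ = differences 2 0 (pad xs)
    ε : List Bool
    ε = proj₁ (codeOfAV xs)
    η : List ℕ
    η = proj₂ (codeOfAV xs)
    padded : Gapped 2 0 (pad xs) × length (pad xs) ≡ 2 * i
    padded = AV⇒padded {i} {xs} xs∈
    length-δ : length δ ≡ 2 * i
    length-δ = trans (length-differences 2 0 (pad xs)) (proj₂ padded)
    zipWith-codeOfAV : zipWith unhalve ε η ≡ δ
    zipWith-codeOfAV = zipWith-unzipWith halve unhalve unhalve-halve δ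

  length-ε : length ε ≡ 2 * i
  length-ε = trans (length-unzipWith₁ halve δ) length-δ

  length-η : length η ≡ 2 * i
  length-η = trans (length-unzipWith₂ halve δ) length-δ

  AVOfCode-codeOfAV : AVOfCode ε η ≡ xs
  AVOfCode-codeOfAV = begin
    unpad (accumulate 2 0 (zipWith unhalve ε η))  ≡⟨ cong (unpad ∘ accumulate 2 0) zipWith-codeOfAV ⟩
    unpad (accumulate 2 0 δ)                      ≡⟨ cong unpad (accumulate-differences (proj₁ padded)) ⟩
    unpad (pad xs)                                ≡⟨ unpad-pad (proj₁ (to (isAV⇔Gapped {i} {xs}) xs∈)) ⟩
    xs                                            ∎
    where open ≡-Reasoning

  sum-codeOfAV : sum xs ≡ 2 * sum (accumulate 1 0 η) + bitWeight ε
  sum-codeOfAV = begin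
    sum xs                                        ≡⟨ sym (sum-pad xs) ⟩
    sum (pad xs)                                  ≡⟨ cong sum (sym (accumulate-differences (proj₁ padded))) ⟩
    sum (accumulate 2 0 δ)                        ≡⟨ cong (sum ∘ accumulate 2 0) (sym zipWith-codeOfAV) ⟩
    sum (accumulate 2 0 (zipWith unhalve ε η))    ≡⟨ sum-accumulate-unhalve ε η (trans length-ε (sym length-η)) ⟩
    2 * sum (accumulate 1 0 η) + bitWeight ε      ∎
    where open ≡-Reasoning

  module _ {μ} (μ∈ : T (isBV i μ)) where

    Gapped-BV : Gapped 1 (suc (length ε)) μ
    Gapped-BV = subst (λ n → Gapped 1 (suc n) μ) (sym length-ε) (to (isBV⇔Gapped {i}) μ∈)

    extractSmall-insertSmall-BV : extractSmall (2 * i) (insertSmall ε μ) ≡ (ε , μ)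
    extractSmall-insertSmall-BV =
      subst (λ n → extractSmall n (insertSmall ε μ) ≡ (ε , μ)) length-ε (extractSmall-insertSmall ε Gapped-BV)

module _ {i : ℕ} {ε : List Bool} {η : List ℕ} (|ε| : length ε ≡ 2 * i) (|η| : length η ≡ 2 * i) where

  private
    ys : List ℕ
    ys = accumulate 2 0 (zipWith unhalve ε η)
    length-ys : length ys ≡ 2 * i
    length-ys = begin
      length ys                    ≡⟨ length-accumulate 2 0 (zipWith unhalve ε η) ⟩
      length (zipWith unhalve ε η) ≡⟨ length-zipWith unhalve ε η ⟩
      length ε ⊓ length η          ≡⟨ cong₂ _⊓_ |ε| |η| ⟩
      (2 * i) ⊓ (2 * i)            ≡⟨ ⊓-idem (2 * i) ⟩
      2 * i                        ∎
      where open ≡-Reasoning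

  isAV-AVOfCode : T (isAV i (AVOfCode ε η))
  isAV-AVOfCode = padded⇒AV {i} {ys} (Gapped-accumulate 2 0 (zipWith unhalve ε η)) length-ys

  codeOfAV-AVOfCode : codeOfAV (AVOfCode ε η) ≡ (ε , η)
  codeOfAV-AVOfCode = begin
    unzipWith halve (differences 2 0 (pad (unpad ys)))
      ≡⟨ cong (unzipWith halve ∘ differences 2 0) (pad-unpad ys (subst (T ∘ even) (sym length-ys) (even-2*n i))) ⟩
    unzipWith halve (differences 2 0 ys)
      ≡⟨ cong (unzipWith halve) (differences-accumulate 2 0 (zipWith unhalve ε η)) ⟩
    unzipWith halve (zipWith unhalve ε η)
      ≡⟨ unzipWith-zipWith halve unhalve halve-unhalve ε η (trans |ε| (sym |η|)) ⟩
    (ε , η)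
      ∎
    where open ≡-Reasoning

codeOfDe : List ℕ → List ℕ
codeOfDe β = differences 1 0 (pad (map ⌊_/2⌋ β))

DeOfCode : List ℕ → List ℕ
DeOfCode η = map (2 *_) (unpad (accumulate 1 0 η))

isDe-DeOfCode : ∀ η → T (isDe (DeOfCode η))
isDe-DeOfCode η = doubles⇒isDe (Gapped-unpad (Gapped-accumulate 1 0 η))

sum-DeOfCode : ∀ η → sum (DeOfCode η) ≡ 2 * sum (accumulate 1 0 η)
sum-DeOfCode η = trans (sum-map-* 2 (unpad (accumulate 1 0 η))) (cong (2 *_) (sum-unpad (accumulate 1 0 η)))

even-length-codeOfDe : ∀ β → T (even (length (codeOfDe β)))
even-length-codeOfDe β =
  subst (T ∘ even) (sym (length-differences 1 0 (pad (map ⌊_/2⌋ β)))) (even-length-pad (map ⌊_/2⌋ β))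

DeOfCode-codeOfDe : ∀ {β} → T (isDe β) → DeOfCode (codeOfDe β) ≡ β
DeOfCode-codeOfDe {β} β∈ = begin
  map (2 *_) (unpad (accumulate 1 0 (differences 1 0 (pad hs))))
    ≡⟨ cong (map (2 *_) ∘ unpad) (accumulate-differences (Gapped-pad (proj₁ halves))) ⟩
  map (2 *_) (unpad (pad hs))
    ≡⟨ cong (map (2 *_)) (unpad-pad (proj₁ halves)) ⟩
  map (2 *_) hs
    ≡⟨ proj₂ halves ⟩
  β ∎
  where
  open ≡-Reasoning
  hs : List ℕ
  hs = map ⌊_/2⌋ β
  halves : Gapped 1 1 hs × map (2 *_) hs ≡ β
  halves = isDe⇒halves {β} β∈

codeOfDe-DeOfCode : ∀ {η} → T (even (length η)) → codeOfDe (DeOfCode η) ≡ η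
codeOfDe-DeOfCode {η} ev = begin
  differences 1 0 (pad (map ⌊_/2⌋ (map (2 *_) (unpad ys))))
    ≡⟨ cong (differences 1 0 ∘ pad) (map-⌊/2⌋-2* (unpad ys)) ⟩
  differences 1 0 (pad (unpad ys))
    ≡⟨ cong (differences 1 0) (pad-unpad ys (subst (T ∘ even) (sym (length-accumulate 1 0 η)) ev)) ⟩
  differences 1 0 ys
    ≡⟨ differences-accumulate 1 0 η ⟩
  η ∎
  where
  open ≡-Reasoning
  ys : List ℕ
  ys = accumulate 1 0 η

encodeAV : Domain → Code
encodeAV (i , (xs , xs∈) , (μ , μ∈)) =
  i , (η , length-η {i} {xs} xs∈) ,
      (insertSmall ε μ , from isD⇔Gapped (Gapped-insertSmall ε (Gapped-BV {i} {xs} xs∈ μ∈)))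
  where
  ε : List Bool
  ε = proj₁ (codeOfAV xs)
  η : List ℕ
  η = proj₂ (codeOfAV xs)

decodeAV : Code → Domain
decodeAV (i , (η , |η|) , (γ , γ∈)) =
  i , (AVOfCode ε η , isAV-AVOfCode {i} {ε} {η} (length-extractSmall (2 * i) γ) |η|) ,
      (μ , from (isBV⇔Gapped {i}) (Gapped-extractSmall (2 * i) (to isD⇔Gapped γ∈)))
  where
  ε : List Bool
  ε = proj₁ (extractSmall (2 * i) γ)
  μ : List ℕ
  μ = proj₂ (extractSmall (2 * i) γ)

decodeAV-encodeAV : ∀ x → decodeAV (encodeAV x) ≡ x
decodeAV-encodeAV (i , (xs , xs∈) , (μ , μ∈)) =
  cong (i ,_) (cong₂ _,_ (subset-≡ recovered) (subset-≡ (cong proj₂ extracted)))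
  where
  ε : List Bool
  ε = proj₁ (codeOfAV xs)
  η : List ℕ
  η = proj₂ (codeOfAV xs)
  extracted : extractSmall (2 * i) (insertSmall ε μ) ≡ (ε , μ)
  extracted = extractSmall-insertSmall-BV {i} {xs} xs∈ μ∈
  recovered : AVOfCode (proj₁ (extractSmall (2 * i) (insertSmall ε μ))) η ≡ xs
  recovered = trans (cong (λ ε′ → AVOfCode ε′ η) (cong proj₁ extracted)) (AVOfCode-codeOfAV {i} {xs} xs∈)

encodeAV-decodeAV : ∀ c → encodeAV (decodeAV c) ≡ c
encodeAV-decodeAV (i , (η , |η|) , (γ , γ∈)) =
  Code-≡ refl (cong proj₂ coded)
    (trans (cong (λ ε′ → insertSmall ε′ μ) (cong proj₁ coded)) (insertSmall-extractSmall (2 * i) γ))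
  where
  ε : List Bool
  ε = proj₁ (extractSmall (2 * i) γ)
  μ : List ℕ
  μ = proj₂ (extractSmall (2 * i) γ)
  coded : codeOfAV (AVOfCode ε η) ≡ (ε , η)
  coded = codeOfAV-AVOfCode {i} {ε} {η} (length-extractSmall (2 * i) γ) |η|

codeWeight-encodeAV : ∀ (x : Domain) →
                      codeWeight (encodeAV x) ≡ ∣ proj₁ (proj₁ (proj₂ x)) ∣ₚ + ∣ proj₁ (proj₂ (proj₂ x)) ∣ₚ
codeWeight-encodeAV (i , (xs , xs∈) , (μ , μ∈)) = begin
  2 * A + sum (insertSmall ε μ)   ≡⟨ cong (2 * A +_) (sum-insertSmall ε μ) ⟩
  2 * A + (bitWeight ε + sum μ)   ≡⟨ sym (+-assoc (2 * A) (bitWeight ε) (sum μ)) ⟩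
  2 * A + bitWeight ε + sum μ     ≡⟨ cong (_+ sum μ) (sym (sum-codeOfAV {i} {xs} xs∈)) ⟩
  sum xs + sum μ                  ∎
  where
  open ≡-Reasoning
  ε : List Bool
  ε = proj₁ (codeOfAV xs)
  A : ℕ
  A = sum (accumulate 1 0 (proj₂ (codeOfAV xs)))

encodeDe : De × D → Code
encodeDe ((β , _) , γ) =
  ⌊ length (codeOfDe β) /2⌋ , (codeOfDe β , sym (even⇒2*⌊n/2⌋≡n (even-length-codeOfDe β))) , γ

decodeDe : Code → De × D
decodeDe (_ , (η , _) , γ) = (DeOfCode η , isDe-DeOfCode η) , γ

decodeDe-encodeDe : ∀ y → decodeDe (encodeDe y) ≡ y
decodeDe-encodeDe ((β , β∈) , γ) = cong (_, γ) (subset-≡ (DeOfCode-codeOfDe β∈))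

encodeDe-decodeDe : ∀ c → encodeDe (decodeDe c) ≡ c
encodeDe-decodeDe (i , (η , |η|) , γ) =
  Code-≡ (trans (cong (⌊_/2⌋ ∘ length) coded) (trans (cong ⌊_/2⌋ |η|) (⌊2*n/2⌋≡n i))) coded refl
  where
  coded : codeOfDe (DeOfCode η) ≡ η
  coded = codeOfDe-DeOfCode (subst (T ∘ even) (sym |η|) (even-2*n i))

size-decodeDe : ∀ c → let y = decodeDe c in ∣ proj₁ (proj₁ y) ∣ₚ + ∣ proj₁ (proj₂ y) ∣ₚ ≡ codeWeight c
size-decodeDe (_ , (η , _) , (γ , _)) = cong (_+ sum γ) (sum-DeOfCode η)

AV↔Code : Domain ↔ Code
AV↔Code = mk↔ₛ′ encodeAV decodeAV encodeAV-decodeAV decodeAV-encodeAV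

De↔Code : (De × D) ↔ Code
De↔Code = mk↔ₛ′ encodeDe decodeDe encodeDe-decodeDe decodeDe-encodeDe

theorem3p2 : Σ (Domain ⤖ (De × D))
      (λ θ → (x : Domain) →
        ∣ proj₁ (proj₁ (proj₂ x)) ∣ₚ + ∣ proj₁ (proj₂ (proj₂ x)) ∣ₚ
          ≡ ∣ proj₁ (proj₁ (Bijection.to θ x)) ∣ₚ + ∣ proj₁ (proj₂ (Bijection.to θ x)) ∣ₚ)
theorem3p2 = ↔⇒⤖ (↔-trans AV↔Code (↔-sym De↔Code)) ,
             λ x → trans (sym (codeWeight-encodeAV x)) (sym (size-decodeDe (encodeAV x)))
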